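{- Let $f(z)=\sum_{m\ge1}a(m)q^m$ be a normalized Hecke eigenform in $S_3(\Gamma,\chi)$ whose Fourier coefficients $a(m)$ are all rational integers. Let $p$ be a prime with $\chi(p)=1$, and let $\alpha_0$ be the least positive integer $\alpha$ with $a(p^\alpha)=0$ (if such $\alpha$ exists). If $a(p)\neq\pm p$ and $\alpha_0$ is finite, then $\alpha_0=1$.
   Context: $S_3(\Gamma,\chi)$ is the space of holomorphic cusp forms of weight $3$ for the congruence subgroup $\Gamma=\Gamma_0(N)$ with Dirichlet character $\chi$ modulo $N$. A normalized Hecke eigenform is a cusp form which is an eigenvector of all Hecke operators and has $a(1)=1$; its coefficients satisfy $a(mn)=a(m)a(n)$ for $\gcd(m,n)=1$ and $a(p^{\alpha+1})=a(p)a(p^\alpha)-\chi(p)p^{2}a(p^{\alpha-1})$ for primes $p$. -}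

module Defs where

open import Data.Nat using (ℕ; suc; _^_)
open import Data.Integer using (ℤ; +_; _*_; _-_)
open import Relation.Binary.PropositionalEquality using (_≡_)

-- Hecke relations at the prime power tower of p for the coefficient
-- function a : ℕ → ℤ of a normalized eigenform of weight 3, specialised to
-- χ(p) = 1:  a(1) = 1 and a(p^(α+1)) = a(p) a(p^α) - p^2 a(p^(α-1)).
record HeckeAtPrime (a : ℕ → ℤ) (p : ℕ) : Set where
  field
    normalized : a 1 ≡ + 1
    recurrence : ∀ α → a (p ^ suc (suc α))
                       ≡ a p * a (p ^ suc α) - (+ p) * (+ p) * a (p ^ α)

-- Write u n = a (p ^ n), so u 0 = 1, u 1 = a p and
-- u (n + 2) = a p · u (n + 1) - p² · u n.  It suffices to show that u never
-- vanishes at a positive index once a p ∉ {0, p, -p}, since minimality of α₀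
-- then forces α₀ = 1.  If p ∤ a p, reducing the recurrence mod p shows that
-- p ∤ u n for all n ≥ 1.  If p ∣ a p then |a p| ≥ 2p, and the recurrence
-- makes |u| grow: p |u n| < |u (n + 1)| is preserved, because
-- |u (n + 2)| ≥ 2p |u (n + 1)| - p² |u n| > p |u (n + 1)|.
module Submission where

open import Defs
open import Data.Nat as ℕ using (ℕ; zero; suc; _^_; _≤_; _<_; s≤s; z≤n; NonZero)
import Data.Nat.Properties as ℕ
import Data.Nat.Divisibility as ℕ
open import Data.Nat.Primality using (Prime; euclidsLemma; prime⇒nonTrivial)
open import Data.Integer as ℤ using (ℤ; +_; -_; ∣_∣; _*_; _+_; _-_)
import Data.Integer.Properties as ℤ
open import Data.Integer.Divisibility.Signed using (_∣_; _∣?_; ∣-refl; ∣⇒∣ᵤ; ∣ᵤ⇒∣; ∣m∣n⇒∣m+n; ∣m⇒∣m*n)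
open import Data.Integer.Tactic.RingSolver using (solve-∀)
open import Data.Empty using (⊥-elim)
open import Data.Sum as Sum using (_⊎_; inj₁; inj₂; [_,_]′)
open import Relation.Nullary using (¬_; yes; no; contradiction)
open import Relation.Binary.PropositionalEquality using (_≡_; _≢_; refl; sym; trans; cong; subst)
open import Function using (_∘_)

record LinearRecurrence (t r : ℤ) (u : ℕ → ℤ) : Set where
  constructor linearRecurrence
  field
    step : ∀ n → u (suc (suc n)) ≡ t * u (suc n) - r * u n

recurrence-rearranged : ∀ {t r u} → LinearRecurrence t r u →
                        ∀ n → t * u (suc n) ≡ u (suc (suc n)) + r * u n
recurrence-rearranged {t} {r} {u} rec n = trans (sub-add (t * u (suc n)) (r * u n))
                                               (cong (_+ r * u n) (sym (LinearRecurrence.step rec n)))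
  where
  sub-add : ∀ x y → x ≡ (x - y) + y
  sub-add = solve-∀

prime-∣-* : ∀ {p} → Prime p → ∀ i j → + p ∣ i * j → (+ p ∣ i) ⊎ (+ p ∣ j)
prime-∣-* {p} pr i j p∣ij =
  Sum.map ∣ᵤ⇒∣ ∣ᵤ⇒∣ (euclidsLemma ∣ i ∣ ∣ j ∣ pr (subst (p ℕ.∣_) (ℤ.abs-* i j) (∣⇒∣ᵤ p∣ij)))

prime∤-recurrence : ∀ {p t r u} → Prime p → ¬ (+ p ∣ t) → + p ∣ r →
                    LinearRecurrence t r u → ¬ (+ p ∣ u 1) → ∀ n → ¬ (+ p ∣ u (suc n))
prime∤-recurrence pr p∤t p∣r rec p∤u₁ zero = p∤u₁
prime∤-recurrence {p} {t} {r} {u} pr p∤t p∣r rec p∤u₁ (suc n) p∣u =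
  [ p∤t , prime∤-recurrence pr p∤t p∣r rec p∤u₁ n ]′ (prime-∣-* pr t (u (suc n)) p∣tu)
  where
  p∣tu : + p ∣ t * u (suc n)
  p∣tu = subst (+ p ∣_) (sym (recurrence-rearranged rec n))
               (∣m∣n⇒∣m+n p∣u (∣m⇒∣m*n (u n) p∣r))

recurrence-growth : ∀ {q t u} .{{_ : NonZero q}} → q ℕ.+ q ≤ ∣ t ∣ →
                    LinearRecurrence t (+ q * + q) u →
                    q ℕ.* ∣ u 0 ∣ < ∣ u 1 ∣ → ∀ n → q ℕ.* ∣ u n ∣ < ∣ u (suc n) ∣
recurrence-growth q+q≤t rec base zero = base
recurrence-growth {q} {t} {u} q+q≤t rec base (suc n) =
  ℕ.+-cancelʳ-< (q ℕ.* v) (q ℕ.* v) w (begin-strict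
    q ℕ.* v ℕ.+ q ℕ.* v          ≡⟨ ℕ.*-distribʳ-+ v q q ⟨
    (q ℕ.+ q) ℕ.* v              ≤⟨ ℕ.*-monoˡ-≤ v q+q≤t ⟩
    ∣ t ∣ ℕ.* v                  ≤⟨ triangle ⟩
    w ℕ.+ q ℕ.* q ℕ.* x          <⟨ ℕ.+-monoʳ-< w qqx<qv ⟩
    w ℕ.+ q ℕ.* v                ∎)
  where
  open ℕ.≤-Reasoning
  x = ∣ u n ∣
  v = ∣ u (suc n) ∣
  w = ∣ u (suc (suc n)) ∣

  triangle : ∣ t ∣ ℕ.* v ≤ w ℕ.+ q ℕ.* q ℕ.* x
  triangle = begin
    ∣ t ∣ ℕ.* v                          ≡⟨ ℤ.abs-* t (u (suc n)) ⟨
    ∣ t * u (suc n) ∣                    ≡⟨ cong ∣_∣ (recurrence-rearranged rec n) ⟩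
    ∣ u (suc (suc n)) + + q * + q * u n ∣ ≤⟨ ℤ.∣i+j∣≤∣i∣+∣j∣ (u (suc (suc n))) (+ q * + q * u n) ⟩
    w ℕ.+ ∣ + q * + q * u n ∣            ≡⟨ cong (w ℕ.+_) (ℤ.abs-* (+ q * + q) (u n)) ⟩
    w ℕ.+ ∣ + q * + q ∣ ℕ.* x            ≡⟨ cong (λ k → w ℕ.+ k ℕ.* x) (ℤ.abs-* (+ q) (+ q)) ⟩
    w ℕ.+ q ℕ.* q ℕ.* x                  ∎

  qqx<qv : q ℕ.* q ℕ.* x < q ℕ.* v
  qqx<qv = subst (_< q ℕ.* v) (sym (ℕ.*-assoc q q x))
                 (ℕ.*-monoʳ-< q (recurrence-growth q+q≤t rec base n))

m∣n⇒n≡0⊎n≡m⊎m+m≤n : ∀ {m n} → m ℕ.∣ n → n ≡ 0 ⊎ n ≡ m ⊎ m ℕ.+ m ≤ n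
m∣n⇒n≡0⊎n≡m⊎m+m≤n (ℕ.divides zero n≡0) = inj₁ n≡0
m∣n⇒n≡0⊎n≡m⊎m+m≤n {m} (ℕ.divides 1 n≡m+0) = inj₂ (inj₁ (trans n≡m+0 (ℕ.+-identityʳ m)))
m∣n⇒n≡0⊎n≡m⊎m+m≤n {m} (ℕ.divides (suc (suc k)) n≡m+m+km) =
  inj₂ (inj₂ (subst (m ℕ.+ m ≤_) (sym n≡m+m+km) (ℕ.+-monoʳ-≤ m (ℕ.m≤m+n m (k ℕ.* m)))))

∣i∣≡n⇒i≡+n⊎i≡-n : ∀ {i n} → ∣ i ∣ ≡ n → i ≡ + n ⊎ i ≡ - + n
∣i∣≡n⇒i≡+n⊎i≡-n {i} refl with ℤ.+∣i∣≡i⊎+∣i∣≡-i i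
... | inj₁ +∣i∣≡i  = inj₁ (sym +∣i∣≡i)
... | inj₂ +∣i∣≡-i = inj₂ (trans (sym (ℤ.neg-involutive i)) (cong -_ (sym +∣i∣≡-i)))

module _ {a : ℕ → ℤ} {p : ℕ} (pr : Prime p) (hecke : HeckeAtPrime a p) where
  private
    u : ℕ → ℤ
    u k = a (p ^ k)

    u₁≡ap : u 1 ≡ a p
    u₁≡ap = cong a (ℕ.*-identityʳ p)

    rec : LinearRecurrence (a p) (+ p * + p) u
    rec = linearRecurrence (HeckeAtPrime.recurrence hecke)

  p∤a[p]⇒a[p^1+n]≢0 : ¬ (+ p ∣ a p) → ∀ n → a (p ^ suc n) ≢ + 0
  p∤a[p]⇒a[p^1+n]≢0 p∤ap n u[1+n]≡0 =
    prime∤-recurrence pr p∤ap p∣p² rec p∤u₁ n (subst (+ p ∣_) (sym u[1+n]≡0) p∣0)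
    where
    p∣p² : + p ∣ + p * + p
    p∣p² = ∣m⇒∣m*n (+ p) ∣-refl

    p∣0 : + p ∣ + 0
    p∣0 = ∣ᵤ⇒∣ (p ℕ.∣0)

    p∤u₁ : ¬ (+ p ∣ u 1)
    p∤u₁ = p∤ap ∘ subst (+ p ∣_) u₁≡ap

  p∣a[p]⇒a[p^1+n]≢0 : + p ∣ a p → a p ≢ + 0 → a p ≢ + p → a p ≢ - + p →
                      ∀ n → a (p ^ suc n) ≢ + 0
  p∣a[p]⇒a[p^1+n]≢0 p∣ap ap≢0 ap≢p ap≢-p n u[1+n]≡0 =
    ℕ.m<n⇒n≢0 (recurrence-growth p+p≤∣ap∣ rec base n) (cong ∣_∣ u[1+n]≡0)
    where
    instance
      p≢0 : NonZero p
      p≢0 = ℕ.nonTrivial⇒nonZero p {{prime⇒nonTrivial pr}}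

    p+p≤∣ap∣ : p ℕ.+ p ≤ ∣ a p ∣
    p+p≤∣ap∣ with m∣n⇒n≡0⊎n≡m⊎m+m≤n (∣⇒∣ᵤ p∣ap)
    ... | inj₁ ∣ap∣≡0          = contradiction (ℤ.∣i∣≡0⇒i≡0 ∣ap∣≡0) ap≢0
    ... | inj₂ (inj₁ ∣ap∣≡p)   = ⊥-elim ([ ap≢p , ap≢-p ]′ (∣i∣≡n⇒i≡+n⊎i≡-n ∣ap∣≡p))
    ... | inj₂ (inj₂ p+p≤∣ap∣) = p+p≤∣ap∣

    base : p ℕ.* ∣ u 0 ∣ < ∣ u 1 ∣
    base = begin-strict
      p ℕ.* ∣ u 0 ∣ ≡⟨ cong (λ k → p ℕ.* ∣ k ∣) (HeckeAtPrime.normalized hecke) ⟩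
      p ℕ.* 1       ≡⟨ ℕ.*-identityʳ p ⟩
      p             <⟨ ℕ.m<m+n p (ℕ.>-nonZero⁻¹ p) ⟩
      p ℕ.+ p       ≤⟨ p+p≤∣ap∣ ⟩
      ∣ a p ∣       ≡⟨ cong ∣_∣ u₁≡ap ⟨
      ∣ u 1 ∣       ∎
      where open ℕ.≤-Reasoning

  a[p]∉0,±p⇒a[p^1+n]≢0 : a p ≢ + 0 → a p ≢ + p → a p ≢ - + p → ∀ n → a (p ^ suc n) ≢ + 0
  a[p]∉0,±p⇒a[p^1+n]≢0 ap≢0 ap≢p ap≢-p with + p ∣? a p
  ... | no p∤ap = p∤a[p]⇒a[p^1+n]≢0 p∤ap
  ... | yes p∣ap = p∣a[p]⇒a[p^1+n]≢0 p∣ap ap≢0 ap≢p ap≢-p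

proposition3p1 : (a : ℕ → ℤ) (p : ℕ) → Prime p → HeckeAtPrime a p →
    a p ≢ + p → a p ≢ - (+ p) →
    (α₀ : ℕ) → 1 ≤ α₀ → a (p ^ α₀) ≡ + 0 →
    (∀ β → 1 ≤ β → β < α₀ → a (p ^ β) ≢ + 0) →
    α₀ ≡ 1
proposition3p1 a p pr hecke ap≢p ap≢-p (suc zero) _ _ _ = refl
proposition3p1 a p pr hecke ap≢p ap≢-p (suc (suc α)) _ a[p^α₀]≡0 minimal =
  contradiction a[p^α₀]≡0 (a[p]∉0,±p⇒a[p^1+n]≢0 pr hecke ap≢0 ap≢p ap≢-p (suc α))
  where
  ap≢0 : a p ≢ + 0
  ap≢0 = minimal 1 (s≤s z≤n) (s≤s (s≤s z≤n)) ∘ trans (cong a (ℕ.*-identityʳ p))
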